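{- Let $A$ be a circular $m\times n$ matrix and $\Gamma$ a closed directed (not necessarily simple) path in $D(A)$. Then for every $j\in[n]$, $p^+(\Gamma,j)-p^-(\Gamma,j)=p(\Gamma)$.
   Context: $[n]=\{1,\dots,n\}$ with addition mod $n$ (node $0$ identified with $n$); $[a,c)_n$ denotes the cyclic interval $\{a,\dots,c-1\}$ mod $n$. A $\{0,1\}$ $m\times n$ matrix $A$ is circular if each row $i$ is the incidence vector of $[\ell_i,\ell_i+k_i)_n$ with $\ell_i,k_i\in[n]$, $2\le k_i\le n-1$. $D(A)$: node set $[n]$; forward row arcs $a_i=(\ell_i-1,\ell_i+k_i-1)$ (length $k_i$), forward short arcs $a_{m+j}=(j-1,j)$ (length 1), reverse row arcs $\bar a_i=(\ell_i+k_i-1,\ell_i-1)$ (length $-k_i$), reverse short arcs $\bar a_{m+j}=(j,j-1)$ (length $-1$). The winding number of a closed directed path $\Gamma$ is the integer $p(\Gamma)$ with $p(\Gamma)n=\sum_{a\in E(\Gamma)}l(a)$ (arcs counted with multiplicity). A forward row arc $a_i$ jumps over $j$ iff $j\in[\ell_i,\ell_i+k_i)_n$; the forward short arc $(j-1,j)$ jumps over $j$ only; a reverse arc jumps over $j$ iff the antiparallel forward arc does. $p^+(\Gamma,j)$ (resp. $p^-(\Gamma,j)$) is the number of forward (resp. reverse) arcs of $\Gamma$, counted with multiplicity, jumping over $j$. -}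

module Defs where

open import Data.Nat using (ℕ; zero; suc; _+_; _∸_; _≤_; _<_; NonZero; _≡ᵇ_)
open import Data.Empty using (⊥)
open import Data.Nat.DivMod using (_%_)
open import Data.Fin using (Fin; toℕ)
open import Data.Bool using (Bool; true; false; _∧_; not)
open import Data.List using (List; []; _∷_; _++_; [_]; upTo; length)
open import Data.Bool.ListAction using (any)
open import Data.List.Relation.Unary.Linked using (Linked)
open import Data.Integer using (ℤ; +_; -_) renaming (_+_ to _+ℤ_)
import Data.Nat.Properties as ℕP
open import Relation.Binary.PropositionalEquality using (_≡_)
open import Data.Product using (_×_)

-- A circular m×n matrix, given by its row data: row i is the incidence
-- vector of the cyclic interval [ℓ i, ℓ i + k i)_n, with ℓ i, k i ∈ [n]
-- and 2 ≤ k i ≤ n - 1.  (Such an interval determines (ℓ i, k i) uniquely,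
-- so this data is the same as the matrix.)
record Circular (m n : ℕ) : Set where
  field
    ℓ    : Fin m → ℕ
    k    : Fin m → ℕ
    ℓ≥1  : ∀ i → 1 ≤ ℓ i
    ℓ≤n  : ∀ i → ℓ i ≤ n
    k≥2  : ∀ i → 2 ≤ k i
    k≤n-1 : ∀ i → k i ≤ n ∸ 1

inCyc : (n : ℕ) → .{{NonZero n}} → ℕ → ℕ → ℕ → Bool
inCyc n a c j = any (λ t → isEq ((a + t) % n) (j % n)) (upTo c)
  where
  isEq : ℕ → ℕ → Bool
  isEq x y = x ≡ᵇ y

-- Arcs of D(A).  Short arcs are indexed by s : Fin n, standing for
-- j = toℕ s + 1 ∈ [n], i.e. the arc (j-1, j).
data Arc (m n : ℕ) : Set where
  fwdRow   : Fin m → Arc m n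
  fwdShort : Fin n → Arc m n
  revRow   : Fin m → Arc m n
  revShort : Fin n → Arc m n

filterB : {X : Set} → (X → Bool) → List X → List X
filterB f []       = []
filterB f (x ∷ xs) with f x
... | true  = x ∷ filterB f xs
... | false = filterB f xs

module _ {m n : ℕ} .{{_ : NonZero n}} (A : Circular m n) where
  open Circular A

  -- nodes of D(A) are [n] with node n identified with 0; we represent a
  -- node by its residue mod n.
  tail head : Arc m n → ℕ
  tail (fwdRow i)   = (ℓ i ∸ 1) % n
  tail (fwdShort s) = toℕ s % n
  tail (revRow i)   = (ℓ i + k i ∸ 1) % n
  tail (revShort s) = (toℕ s + 1) % n
  head (fwdRow i)   = (ℓ i + k i ∸ 1) % n
  head (fwdShort s) = (toℕ s + 1) % n
  head (revRow i)   = (ℓ i ∸ 1) % n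
  head (revShort s) = toℕ s % n

  arcLength : Arc m n → ℤ
  arcLength (fwdRow i)   = + k i
  arcLength (fwdShort s) = + 1
  arcLength (revRow i)   = - (+ k i)
  arcLength (revShort s) = - (+ 1)

  isForward : Arc m n → Bool
  isForward (fwdRow _)   = true
  isForward (fwdShort _) = true
  isForward (revRow _)   = false
  isForward (revShort _) = false

  jumpsOver : ℕ → Arc m n → Bool
  jumpsOver j (fwdRow i)   = inCyc n (ℓ i) (k i) j
  jumpsOver j (fwdShort s) = inCyc n (toℕ s + 1) 1 j
  jumpsOver j (revRow i)   = inCyc n (ℓ i) (k i) j
  jumpsOver j (revShort s) = inCyc n (toℕ s + 1) 1 j

  -- a closed directed path: a nonempty sequence of arcs a₀ a₁ … a_r with
  -- head aₜ = tail aₜ₊₁ and head a_r = tail a₀ (arcs and nodes may repeat)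
  Consecutive : Arc m n → Arc m n → Set
  Consecutive a b = head a ≡ tail b

  IsClosedPath : List (Arc m n) → Set
  IsClosedPath []       = ⊥
  IsClosedPath (a ∷ as) = Linked Consecutive (a ∷ as ++ [ a ])

  totalLength : List (Arc m n) → ℤ
  totalLength []       = + 0
  totalLength (a ∷ as) = arcLength a +ℤ totalLength as

  p⁺ : List (Arc m n) → ℕ → ℕ
  p⁺ Γ j = length (filterB (λ a → isForward a ∧ jumpsOver j a) Γ)

  p⁻ : List (Arc m n) → ℕ → ℕ
  p⁻ Γ j = length (filterB (λ a → not (isForward a) ∧ jumpsOver j a) Γ)

-- Let w(a) be the number of times the arc a passes node n ≡ 0 (counted negatively for reverse
-- arcs); with nodes read as residues in [0, n), l(a) + tail(a) = w(a)·n + head(a).  Summed around a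
-- closed path the node terms telescope, hence l(Γ) = n·Σ w(a) and p(Γ) = Σ w(a).  For fixed j the same
-- telescoping with the potential v ↦ [v < j] works, because
--   w(a) + [tail(a) < j] = ±[a jumps over j] + [head(a) < j]    (+ for forward arcs, − for reverse ones),
-- and it gives Σ w(a) = p⁺(Γ,j) − p⁻(Γ,j).

module Submission where

open import Defs
open import Data.Bool using (Bool; true; false; T; not; _∧_)
open import Data.Fin using (toℕ)
open import Data.Fin.Properties using (toℕ<n)
open import Data.List using (List; []; _∷_; _++_; [_]; length; upTo)
open import Data.List.Relation.Unary.Any using (Any)
open import Data.List.Relation.Unary.Any.Properties using (any⇔; applyUpTo⁺; applyUpTo⁻)
open import Data.List.Relation.Unary.Linked using (Linked; [-]; _∷_)
open import Data.Nat using (ℕ; suc; _≤_; _<_; NonZero; z≤n; s≤s; _∸_; _%_; _/_; _<ᵇ_; _≡ᵇ_; _≤?_; _<?_)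
import Data.Nat as Nat
open import Data.Nat.Properties
  using (≤-trans; ≤-<-trans; <⇒≤; ≤⇒≯; ≮⇒≥; ≰⇒>; >⇒≢; <ᵇ⇒<; <⇒<ᵇ; ≡ᵇ⇒≡; ≡⇒≡ᵇ; m≤n⇒m<n∨m≡n;
         +-comm; +-suc; +-cancelˡ-<; +-monoʳ-≤; +-monoˡ-≤; +-mono-<-≤; m≤m+n; m≤n+m; m+[n∸m]≡n; m∸n+n≡m;
         m<n+o⇒m∸n<o; m<n⇒0<n∸m; ∸-monoˡ-≤; ≤-reflexive; m+n∸n≡m; +-∸-comm; m∸n≤m)
open import Data.Nat.DivMod
  using (m<n⇒m%n≡m; m<n⇒m/n≡0; n%n≡0; [m+n]%n≡m%n; m≤n⇒[n∸m]%m≡n%m; m/n≡1+[m∸n]/n; m≡m%n+[m/n]*n)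
open import Data.Product using (_×_; _,_; ∃)
open import Data.Sum using (_⊎_; inj₁; inj₂)
open import Function using (_∘_; _⇔_; Equivalence; mk⇔)
open import Relation.Nullary using (¬_; contradiction; yes; no)
open import Relation.Binary.PropositionalEquality
  using (_≡_; refl; sym; trans; cong; subst; module ≡-Reasoning)

indicator : Bool → ℕ
indicator true  = 1
indicator false = 0

indicator-T : ∀ {b} → T b → indicator b ≡ 1
indicator-T {true} _ = refl

indicator-¬T : ∀ {b} → ¬ T b → indicator b ≡ 0
indicator-¬T {true}  ¬t = contradiction _ ¬t
indicator-¬T {false} _  = refl

length-filterB-∷ : ∀ {X : Set} (f : X → Bool) x xs →
                   length (filterB f (x ∷ xs)) ≡ indicator (f x) Nat.+ length (filterB f xs)
length-filterB-∷ f x xs with f x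
... | true  = refl
... | false = refl

<ᵇ-indicator-yes : ∀ {u j} → u < j → indicator (u <ᵇ j) ≡ 1
<ᵇ-indicator-yes = indicator-T ∘ <⇒<ᵇ

<ᵇ-indicator-no : ∀ {u j} → j ≤ u → indicator (u <ᵇ j) ≡ 0
<ᵇ-indicator-no {u} {j} j≤u = indicator-¬T (≤⇒≯ j≤u ∘ <ᵇ⇒< u j)

module _ {n : ℕ} .{{_ : NonZero n}} where
  open Nat using (_+_; _*_)

  %-injective-[1,n] : ∀ {a b} → 1 ≤ a → a ≤ n → 1 ≤ b → b ≤ n → a % n ≡ b % n → a ≡ b
  %-injective-[1,n] 1≤a a≤n 1≤b b≤n eq with m≤n⇒m<n∨m≡n a≤n | m≤n⇒m<n∨m≡n b≤n
  ... | inj₁ a<n  | inj₁ b<n  = trans (sym (m<n⇒m%n≡m a<n)) (trans eq (m<n⇒m%n≡m b<n))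
  ... | inj₁ a<n  | inj₂ refl =
    contradiction (trans (sym (m<n⇒m%n≡m a<n)) (trans eq (n%n≡0 n))) (>⇒≢ 1≤a)
  ... | inj₂ refl | inj₁ b<n  =
    contradiction (trans (sym (m<n⇒m%n≡m b<n)) (trans (sym eq) (n%n≡0 n))) (>⇒≢ 1≤b)
  ... | inj₂ refl | inj₂ refl = refl

  n≤m<n+n⇒m%n≡m∸n : ∀ {x} → n ≤ x → x < n + n → x % n ≡ x ∸ n
  n≤m<n+n⇒m%n≡m∸n {x} n≤x x<2n = trans (sym (m≤n⇒[n∸m]%m≡n%m n≤x)) (m<n⇒m%n≡m (m<n+o⇒m∸n<o x n x<2n))

  n≤m<n+n⇒m/n≡1 : ∀ {x} → n ≤ x → x < n + n → x / n ≡ 1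
  n≤m<n+n⇒m/n≡1 {x} n≤x x<2n = trans (m/n≡1+[m∸n]/n n≤x) (cong suc (m<n⇒m/n≡0 (m<n+o⇒m∸n<o x n x<2n)))

  %≡⇒≡∨≡+n : ∀ {j y} → 1 ≤ j → j ≤ n → 1 ≤ y → y < n + n → y % n ≡ j % n → y ≡ j ⊎ y ≡ j + n
  %≡⇒≡∨≡+n {j} {y} 1≤j j≤n 1≤y y<2n eq with y ≤? n
  ... | yes y≤n = inj₁ (%-injective-[1,n] 1≤y y≤n 1≤j j≤n eq)
  ... | no  y≰n = inj₂ (begin
      y           ≡⟨ m∸n+n≡m n≤y ⟨
      (y ∸ n) + n ≡⟨ cong (_+ n) y∸n≡j ⟩
      j + n       ∎)
    where
    open ≡-Reasoning
    n≤y = <⇒≤ (≰⇒> y≰n)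
    y∸n≡j : y ∸ n ≡ j
    y∸n≡j = %-injective-[1,n] (m<n⇒0<n∸m (≰⇒> y≰n)) (<⇒≤ (m<n+o⇒m∸n<o y n y<2n)) 1≤j j≤n
              (trans (m≤n⇒[n∸m]%m≡n%m n≤y) eq)

  length-identity : ∀ {u k x} → u < n → u + k ≡ x → k + u % n ≡ x / n * n + x % n
  length-identity {u} {k} u<n refl = begin
    k + u % n                     ≡⟨ cong (k +_) (m<n⇒m%n≡m u<n) ⟩
    k + u                         ≡⟨ +-comm k u ⟩
    u + k                         ≡⟨ m≡m%n+[m/n]*n (u + k) n ⟩
    (u + k) % n + (u + k) / n * n ≡⟨ +-comm ((u + k) % n) _ ⟩
    (u + k) / n * n + (u + k) % n ∎
    where open ≡-Reasoning

  inCyc⇔ : ∀ {u k j} → T (inCyc n (suc u) k j) ⇔ ∃ λ y → u < y × y ≤ u + k × y % n ≡ j % n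
  inCyc⇔ {u} {k} {j} = mk⇔
    (λ hit → offset⇒point (applyUpTo⁻ _ (Equivalence.from any⇔ hit)))
    (λ (y , u<y , y≤u+k , y≡j) → Equivalence.to any⇔ (point⇒offset y u<y y≤u+k y≡j))
    where
    offset⇒point : (∃ λ t → t < k × T ((suc u + t) % n ≡ᵇ j % n)) →
                   ∃ λ y → u < y × y ≤ u + k × y % n ≡ j % n
    offset⇒point (t , t<k , eq) =
      suc u + t , s≤s (m≤m+n u t) , subst (_≤ u + k) (+-suc u t) (+-monoʳ-≤ u t<k) , ≡ᵇ⇒≡ _ _ eq
    point⇒offset : ∀ y → u < y → y ≤ u + k → y % n ≡ j % n →
                   Any (λ t → T ((suc u + t) % n ≡ᵇ j % n)) (upTo k)
    point⇒offset y u<y y≤u+k eq = applyUpTo⁺ _ (≡⇒≡ᵇ _ _ (subst (λ z → z % n ≡ j % n) (sym y≡) eq)) t<k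
      where
      t = y ∸ suc u
      y≡ : suc u + t ≡ y
      y≡ = m+[n∸m]≡n u<y
      t<k : t < k
      t<k = +-cancelˡ-< (suc u) t k (subst (_< suc u + k) (sym y≡) (s≤s y≤u+k))

  module _ {j : ℕ} (1≤j : 1 ≤ j) (j≤n : j ≤ n) {u k : ℕ} (u<n : u < n) (k≤n : k ≤ n) where

    u+k<n+n : u + k < n + n
    u+k<n+n = +-mono-<-≤ u<n k≤n

    -- As u < n and k ≤ n, the only integers ≡ j (mod n) that (u, u + k] can contain are j and j + n.
    ContainsLift : Set
    ContainsLift = (u < j × j ≤ u + k) ⊎ j + n ≤ u + k

    inCyc-indicator-yes : ContainsLift → indicator (inCyc n (suc u) k j) ≡ 1
    inCyc-indicator-yes (inj₁ (u<j , j≤u+k)) =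
      indicator-T (Equivalence.from inCyc⇔ (j , u<j , j≤u+k , refl))
    inCyc-indicator-yes (inj₂ j+n≤u+k) = indicator-T (Equivalence.from inCyc⇔
      (j + n , ≤-trans u<n (m≤n+m n j) , j+n≤u+k , [m+n]%n≡m%n j n))

    inCyc-indicator-no : ¬ ContainsLift → indicator (inCyc n (suc u) k j) ≡ 0
    inCyc-indicator-no ¬lift = indicator-¬T λ hit → ¬lift (lift (Equivalence.to inCyc⇔ hit))
      where
      lift : (∃ λ y → u < y × y ≤ u + k × y % n ≡ j % n) → ContainsLift
      lift (y , u<y , y≤u+k , eq)
        with %≡⇒≡∨≡+n 1≤j j≤n (≤-trans (s≤s z≤n) u<y) (≤-<-trans y≤u+k u+k<n+n) eq
      ... | inj₁ refl = inj₁ (u<y , y≤u+k)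
      ... | inj₂ refl = inj₂ y≤u+k

    no-second-lap : u + k < n → ¬ j + n ≤ u + k
    no-second-lap u+k<n j+n≤u+k = ≤⇒≯ (≤-trans (m≤n+m n j) j+n≤u+k) u+k<n

    u+k∸n≤u : u + k ∸ n ≤ u
    u+k∸n≤u = ≤-trans (∸-monoˡ-≤ n (+-monoʳ-≤ u k≤n)) (≤-reflexive (m+n∸n≡m u n))

    jumps-without-wrap : u + k < n →
                         indicator (u <ᵇ j) ≡ indicator (inCyc n (suc u) k j) + indicator (u + k <ᵇ j)
    jumps-without-wrap u+k<n with j ≤? u
    ... | yes j≤u
      rewrite inCyc-indicator-no (λ { (inj₁ (u<j , _)) → ≤⇒≯ j≤u u<j
                                    ; (inj₂ far) → no-second-lap u+k<n far })
            | <ᵇ-indicator-no j≤u | <ᵇ-indicator-no (≤-trans j≤u (m≤m+n u k)) = refl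
    ... | no j≰u with j ≤? u + k
    ...   | yes j≤u+k
      rewrite inCyc-indicator-yes (inj₁ (≰⇒> j≰u , j≤u+k))
            | <ᵇ-indicator-yes (≰⇒> j≰u) | <ᵇ-indicator-no j≤u+k = refl
    ...   | no j≰u+k
      rewrite inCyc-indicator-no (λ { (inj₁ (_ , j≤u+k)) → j≰u+k j≤u+k
                                    ; (inj₂ far) → no-second-lap u+k<n far })
            | <ᵇ-indicator-yes (≰⇒> j≰u) | <ᵇ-indicator-yes (≰⇒> j≰u+k) = refl

    jumps-with-wrap : n ≤ u + k →
                      1 + indicator (u <ᵇ j) ≡ indicator (inCyc n (suc u) k j) + indicator (u + k ∸ n <ᵇ j)
    jumps-with-wrap n≤u+k with j ≤? u
    ... | no j≰u
      rewrite inCyc-indicator-yes (inj₁ (≰⇒> j≰u , ≤-trans j≤n n≤u+k))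
            | <ᵇ-indicator-yes (≰⇒> j≰u) | <ᵇ-indicator-yes (≤-<-trans u+k∸n≤u (≰⇒> j≰u)) = refl
    ... | yes j≤u with j ≤? u + k ∸ n
    ...   | yes j≤u+k∸n
      rewrite inCyc-indicator-yes (inj₂ (subst (j + n ≤_) (m∸n+n≡m n≤u+k) (+-monoˡ-≤ n j≤u+k∸n)))
            | <ᵇ-indicator-no j≤u | <ᵇ-indicator-no j≤u+k∸n = refl
    ...   | no j≰u+k∸n
      rewrite inCyc-indicator-no (λ { (inj₁ (u<j , _)) → ≤⇒≯ j≤u u<j
                                    ; (inj₂ far) → j≰u+k∸n (subst (_≤ u + k ∸ n) (m+n∸n≡m j n) (∸-monoˡ-≤ n far)) })
            | <ᵇ-indicator-no j≤u | <ᵇ-indicator-yes (≰⇒> j≰u+k∸n) = refl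

    jump-identity : ∀ {a x} → suc u ≡ a → u + k ≡ x →
                    x / n + indicator (u % n <ᵇ j) ≡ indicator (inCyc n a k j) + indicator (x % n <ᵇ j)
    jump-identity refl refl rewrite m<n⇒m%n≡m u<n with u + k <? n
    ... | yes u+k<n rewrite m<n⇒m%n≡m u+k<n | m<n⇒m/n≡0 u+k<n = jumps-without-wrap u+k<n
    ... | no u+k≮n
      rewrite n≤m<n+n⇒m%n≡m∸n (≮⇒≥ u+k≮n) u+k<n+n | n≤m<n+n⇒m/n≡1 (≮⇒≥ u+k≮n) u+k<n+n =
        jumps-with-wrap (≮⇒≥ u+k≮n)

-- Opened only now, since ℕ and ℤ share the names _+_ and _*_.
open import Data.Integer using (ℤ; +_; -_; _+_; _*_; _-_)
open import Data.Integer.Properties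
  using (pos-+; pos-*; neg-distrib-+; neg-distribˡ-*; *-distribʳ-+; *-cancelʳ-≡; +-assoc; +-identityʳ;
         +-commutativeSemigroup; +-0-abelianGroup)
open import Data.Integer.Tactic.RingSolver using (solve-∀)
open import Algebra.Properties.CommutativeSemigroup +-commutativeSemigroup
  using (x∙yz≈y∙xz; xy∙z≈xz∙y; xy∙z≈x∙zy)
open import Algebra.Properties.AbelianGroup +-0-abelianGroup using (∙-cancelʳ)
open ≡-Reasoning

∑ : {X : Set} → (X → ℤ) → List X → ℤ
∑ f []       = + 0
∑ f (x ∷ xs) = f x + ∑ f xs

∑-*ʳ : ∀ {X : Set} (f : X → ℤ) c xs → ∑ (λ x → f x * c) xs ≡ ∑ f xs * c
∑-*ʳ f c []       = refl
∑-*ʳ f c (x ∷ xs) = trans (cong (λ s → f x * c + s) (∑-*ʳ f c xs)) (sym (*-distribʳ-+ c (f x) (∑ f xs)))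

pos-+-minus : ∀ b p q → + (b Nat.+ p) - + q ≡ + b + (+ p - + q)
pos-+-minus b p q = trans (cong (_- + q) (pos-+ b p)) (+-assoc (+ b) (+ p) (- + q))

minus-pos-+ : ∀ b p q → + p - + (b Nat.+ q) ≡ - + b + (+ p - + q)
minus-pos-+ b p q = begin
  + p - + (b Nat.+ q)   ≡⟨ cong (λ z → + p - z) (pos-+ b q) ⟩
  + p - (+ b + + q)     ≡⟨ cong (λ s → + p + s) (neg-distrib-+ (+ b) (+ q)) ⟩
  + p + (- + b - + q)   ≡⟨ x∙yz≈y∙xz (+ p) (- + b) (- + q) ⟩
  - + b + (+ p - + q)   ∎

negate-balance : ∀ {x y z w} → x + y ≡ z + w → - x + w ≡ - z + y
negate-balance {x} {y} {z} {w} eq = begin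
  - x + w             ≡⟨ regroup x z w ⟩
  (z + w) + (- x - z) ≡⟨ cong (_+ (- x - z)) eq ⟨
  (x + y) + (- x - z) ≡⟨ cancel x y z ⟩
  - z + y             ∎
  where
  regroup : ∀ x z w → - x + w ≡ (z + w) + (- x - z)
  regroup = solve-∀
  cancel : ∀ x y z → (x + y) + (- x - z) ≡ - z + y
  cancel = solve-∀

pos-length-identity : ∀ {n} .{{_ : NonZero n}} {u k x} → u < n → u Nat.+ k ≡ x →
                      + k + + (u % n) ≡ + (x / n) * + n + + (x % n)
pos-length-identity {n} {x = x} u<n eq =
  trans (cong +_ (length-identity u<n eq)) (cong (_+ + (x % n)) (pos-* (x / n) n))

module _ {X N : Set} (src tgt : X → N) (φ : N → ℤ) {F G : X → ℤ}
         (balanced : ∀ x → F x + φ (src x) ≡ G x + φ (tgt x)) where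

  ∑-telescope : ∀ x xs y → Linked (λ a b → tgt a ≡ src b) (x ∷ xs ++ [ y ]) →
                ∑ F (x ∷ xs) + φ (src x) ≡ ∑ G (x ∷ xs) + φ (src y)
  ∑-telescope x [] y (x→y ∷ [-]) = begin
    (F x + + 0) + φ (src x) ≡⟨ cong (_+ φ (src x)) (+-identityʳ (F x)) ⟩
    F x + φ (src x)         ≡⟨ balanced x ⟩
    G x + φ (tgt x)         ≡⟨ cong (λ v → G x + φ v) x→y ⟩
    G x + φ (src y)         ≡⟨ cong (_+ φ (src y)) (+-identityʳ (G x)) ⟨
    (G x + + 0) + φ (src y) ∎
  ∑-telescope x (x′ ∷ xs) y (x→x′ ∷ walk) = begin
    (F x + ∑F′) + φ (src x)  ≡⟨ xy∙z≈xz∙y (F x) ∑F′ (φ (src x)) ⟩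
    (F x + φ (src x)) + ∑F′  ≡⟨ cong (_+ ∑F′) (balanced x) ⟩
    (G x + φ (tgt x)) + ∑F′  ≡⟨ cong (λ v → (G x + φ v) + ∑F′) x→x′ ⟩
    (G x + φ (src x′)) + ∑F′ ≡⟨ xy∙z≈x∙zy (G x) (φ (src x′)) ∑F′ ⟩
    G x + (∑F′ + φ (src x′)) ≡⟨ cong (λ s → G x + s) (∑-telescope x′ xs y walk) ⟩
    G x + (∑G′ + φ (src y))  ≡⟨ +-assoc (G x) ∑G′ (φ (src y)) ⟨
    (G x + ∑G′) + φ (src y)  ∎
    where
    ∑F′ = ∑ F (x′ ∷ xs)
    ∑G′ = ∑ G (x′ ∷ xs)

  ∑-closed-walk : ∀ x xs → Linked (λ a b → tgt a ≡ src b) (x ∷ xs ++ [ x ]) → ∑ F (x ∷ xs) ≡ ∑ G (x ∷ xs)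
  ∑-closed-walk x xs walk = ∙-cancelʳ (φ (src x)) _ _ (∑-telescope x xs x walk)

module _ {m n : ℕ} .{{_ : NonZero n}} (A : Circular m n) where
  open Circular A

  Balanced : (ℕ → ℤ) → (Arc m n → ℤ) → (Arc m n → ℤ) → Set
  Balanced φ F G = ∀ a → F a + φ (tail A a) ≡ G a + φ (head A a)

  ∑-closed-path : ∀ φ {F G} → Balanced φ F G → ∀ Γ → IsClosedPath A Γ → ∑ F Γ ≡ ∑ G Γ
  ∑-closed-path φ {F} {G} balanced (a ∷ as) closed =
    ∑-closed-walk (tail A) (head A) φ {F} {G} balanced a as closed

  wraps : Arc m n → ℤ
  wraps (fwdRow i)   = + ((ℓ i Nat.+ k i ∸ 1) / n)
  wraps (fwdShort s) = + ((toℕ s Nat.+ 1) / n)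
  wraps (revRow i)   = - wraps (fwdRow i)
  wraps (revShort s) = - wraps (fwdShort s)

  below : ℕ → ℕ → ℤ
  below j v = + indicator (v <ᵇ j)

  jumpSign : ℕ → Arc m n → ℤ
  jumpSign j (fwdRow i)   = + indicator (jumpsOver A j (fwdRow i))
  jumpSign j (fwdShort s) = + indicator (jumpsOver A j (fwdShort s))
  jumpSign j (revRow i)   = - jumpSign j (fwdRow i)
  jumpSign j (revShort s) = - jumpSign j (fwdShort s)

  row-start : ∀ i → suc (ℓ i ∸ 1) ≡ ℓ i
  row-start i = m+[n∸m]≡n (ℓ≥1 i)

  row-origin<n : ∀ i → ℓ i ∸ 1 < n
  row-origin<n i = subst (_≤ n) (sym (row-start i)) (ℓ≤n i)

  row-end : ∀ i → (ℓ i ∸ 1) Nat.+ k i ≡ ℓ i Nat.+ k i ∸ 1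
  row-end i = sym (+-∸-comm (k i) (ℓ≥1 i))

  row-length≤n : ∀ i → k i ≤ n
  row-length≤n i = ≤-trans (k≤n-1 i) (m∸n≤m n 1)

  reverse-balanced : ∀ (φ : ℕ → ℤ) (F G : Arc m n → ℤ) a → F a + φ (tail A a) ≡ G a + φ (head A a) →
                     - F a + φ (head A a) ≡ - G a + φ (tail A a)
  reverse-balanced φ F G a = negate-balance {F a} {φ (tail A a)} {G a} {φ (head A a)}

  length-reversed : ∀ a → arcLength A a + + tail A a ≡ wraps a * + n + + head A a →
                    - arcLength A a + + head A a ≡ (- wraps a) * + n + + tail A a
  length-reversed a eq =
    trans (reverse-balanced +_ (arcLength A) (λ a → wraps a * + n) a eq)
          (cong (_+ + tail A a) (neg-distribˡ-* (wraps a) (+ n)))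

  length-balanced : Balanced +_ (arcLength A) (λ a → wraps a * + n)
  length-balanced (fwdRow i)   = pos-length-identity (row-origin<n i) (row-end i)
  length-balanced (fwdShort s) = pos-length-identity (toℕ<n s) refl
  length-balanced (revRow i)   = length-reversed (fwdRow i) (length-balanced (fwdRow i))
  length-balanced (revShort s) = length-reversed (fwdShort s) (length-balanced (fwdShort s))

  jump-balanced : ∀ {j} → 1 ≤ j → j ≤ n → Balanced (below j) wraps (jumpSign j)
  jump-balanced 1≤j j≤n (fwdRow i)   =
    cong +_ (jump-identity 1≤j j≤n (row-origin<n i) (row-length≤n i) (row-start i) (row-end i))
  jump-balanced 1≤j j≤n (fwdShort s) =
    cong +_ (jump-identity 1≤j j≤n (toℕ<n s) (≤-<-trans z≤n (toℕ<n s)) (+-comm 1 (toℕ s)) refl)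
  jump-balanced {j} 1≤j j≤n (revRow i)   =
    reverse-balanced (below j) wraps (jumpSign j) (fwdRow i) (jump-balanced 1≤j j≤n (fwdRow i))
  jump-balanced {j} 1≤j j≤n (revShort s) =
    reverse-balanced (below j) wraps (jumpSign j) (fwdShort s) (jump-balanced 1≤j j≤n (fwdShort s))

  totalLength≡∑ : ∀ Γ → totalLength A Γ ≡ ∑ (arcLength A) Γ
  totalLength≡∑ []       = refl
  totalLength≡∑ (a ∷ as) = cong (λ s → arcLength A a + s) (totalLength≡∑ as)

  p⁺-∷ : ∀ j a as → p⁺ A (a ∷ as) j ≡ indicator (isForward A a ∧ jumpsOver A j a) Nat.+ p⁺ A as j
  p⁺-∷ j = length-filterB-∷ (λ a → isForward A a ∧ jumpsOver A j a)

  p⁻-∷ : ∀ j a as → p⁻ A (a ∷ as) j ≡ indicator (not (isForward A a) ∧ jumpsOver A j a) Nat.+ p⁻ A as j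
  p⁻-∷ j = length-filterB-∷ (λ a → not (isForward A a) ∧ jumpsOver A j a)

  p⁺-p⁻-∷ : ∀ j a as → + p⁺ A (a ∷ as) j - + p⁻ A (a ∷ as) j ≡ jumpSign j a + (+ p⁺ A as j - + p⁻ A as j)
  p⁺-p⁻-∷ j a@(fwdRow _)   as =
    trans (cong (λ c → + c - + p⁻ A as j) (p⁺-∷ j a as))
          (pos-+-minus (indicator (jumpsOver A j a)) (p⁺ A as j) (p⁻ A as j))
  p⁺-p⁻-∷ j a@(fwdShort _) as =
    trans (cong (λ c → + c - + p⁻ A as j) (p⁺-∷ j a as))
          (pos-+-minus (indicator (jumpsOver A j a)) (p⁺ A as j) (p⁻ A as j))
  p⁺-p⁻-∷ j a@(revRow _)   as =
    trans (cong (λ c → + p⁺ A as j - + c) (p⁻-∷ j a as))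
          (minus-pos-+ (indicator (jumpsOver A j a)) (p⁺ A as j) (p⁻ A as j))
  p⁺-p⁻-∷ j a@(revShort _) as =
    trans (cong (λ c → + p⁺ A as j - + c) (p⁻-∷ j a as))
          (minus-pos-+ (indicator (jumpsOver A j a)) (p⁺ A as j) (p⁻ A as j))

  p⁺-p⁻≡∑ : ∀ j Γ → + p⁺ A Γ j - + p⁻ A Γ j ≡ ∑ (jumpSign j) Γ
  p⁺-p⁻≡∑ j []       = refl
  p⁺-p⁻≡∑ j (a ∷ as) = trans (p⁺-p⁻-∷ j a as) (cong (λ s → jumpSign j a + s) (p⁺-p⁻≡∑ j as))

lemma4p1 : ∀ {m n : ℕ} .{{_ : NonZero n}} (A : Circular m n) (Γ : List (Arc m n)) →
    IsClosedPath A Γ →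
    ∃ (λ (p : ℤ) → p * + n ≡ totalLength A Γ) ×
    (∀ (p : ℤ) → p * + n ≡ totalLength A Γ →
      ∀ (j : ℕ) → 1 ≤ j → j ≤ n → + p⁺ A Γ j - + p⁻ A Γ j ≡ p)
lemma4p1 {n = n} A Γ closed = (∑ (wraps A) Γ , winding) , λ p p*n≡length j 1≤j j≤n → begin
  + p⁺ A Γ j - + p⁻ A Γ j ≡⟨ p⁺-p⁻≡∑ A j Γ ⟩
  ∑ (jumpSign A j) Γ      ≡⟨ ∑-closed-path A (below A j) (jump-balanced A 1≤j j≤n) Γ closed ⟨
  ∑ (wraps A) Γ           ≡⟨ *-cancelʳ-≡ _ p (+ n) (trans winding (sym p*n≡length)) ⟩
  p                       ∎
  where
  winding : ∑ (wraps A) Γ * + n ≡ totalLength A Γ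
  winding = begin
    ∑ (wraps A) Γ * + n              ≡⟨ ∑-*ʳ (wraps A) (+ n) Γ ⟨
    ∑ (λ a → wraps A a * + n) Γ      ≡⟨ ∑-closed-path A +_ (length-balanced A) Γ closed ⟨
    ∑ (arcLength A) Γ                ≡⟨ totalLength≡∑ A Γ ⟨
    totalLength A Γ                  ∎
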